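{- Let $F$ be an exponential field in which there exists $t$ with $\mathrm{E}(t)=2$. Let $\Theta(x)$ be the formula $\exists t\,[\mathrm{E}(t)=2\wedge \mathrm{E}(xt)\in\mathbb{Q}\wedge x\in\mathbb{Q}]$, where $\mathbb{Q}$ denotes the prime subfield of $F$. Then for $x\in F$, $F\models\Theta(x)$ if and only if $x\in\mathbb{Z}$ (the integers of the prime subfield of $F$).
   Context: An exponential field is a field $F$ of characteristic $0$ together with a map $\mathrm{E}:F\to F$ satisfying $\mathrm{E}(0)=1$ and $\mathrm{E}(x+y)=\mathrm{E}(x)\mathrm{E}(y)$ for all $x,y\in F$. -}

module Defs where

open import Level using (Level; _⊔_) renaming (suc to lsuc)
open import Algebra.Bundles using (CommutativeRing)
open import Data.Nat using (ℕ; zero; suc)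
open import Data.Integer using (ℤ; +_; -[1+_])
open import Data.Product using (Σ; ∃; ∃₂; _×_)
open import Relation.Nullary using (¬_)
open import Relation.Binary.PropositionalEquality using (_≡_)

module _ {c ℓ : Level} (R : CommutativeRing c ℓ) where
  open CommutativeRing R

  natCast : ℕ → Carrier
  natCast zero    = 0#
  natCast (suc n) = 1# + natCast n

  intCast : ℤ → Carrier
  intCast (+ n)     = natCast n
  intCast -[1+ n ]  = - natCast (suc n)

  IsField : Set (c ⊔ ℓ)
  IsField = (¬ (1# ≈ 0#)) × (∀ x → ¬ (x ≈ 0#) → ∃ λ y → x * y ≈ 1#)

  Char0 : Set ℓ
  Char0 = ∀ n → ¬ (natCast (suc n) ≈ 0#)

  InPrimeSubfield : Carrier → Set ℓ
  InPrimeSubfield x = ∃₂ λ (a b : ℤ) → (¬ (b ≡ + 0)) × (x * intCast b ≈ intCast a)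

  InIntegers : Carrier → Set ℓ
  InIntegers x = ∃ λ (z : ℤ) → x ≈ intCast z

record ExpField (c ℓ : Level) : Set (lsuc (c ⊔ ℓ)) where
  field
    commRing : CommutativeRing c ℓ
  open CommutativeRing commRing public
  field
    isField : IsField commRing
    char0   : Char0 commRing
    E       : Carrier → Carrier
    E-cong  : ∀ {x y} → x ≈ y → E x ≈ E y
    E-0     : E 0# ≈ 1#
    E-+     : ∀ x y → E (x + y) ≈ E x * E y

module _ {c ℓ : Level} (F : ExpField c ℓ) where
  open ExpField F

  Θ : Carrier → Set (c ⊔ ℓ)
  Θ x = ∃ λ t → (E t ≈ natCast commRing 2)
               × InPrimeSubfield commRing (E (x * t))
               × InPrimeSubfield commRing x

module Submission where

-- (⇐) If x = z ∈ ℤ, then E(zt) = 2^z is rational.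
-- (⇒) Write x b = ±K and E(xt) e = ±C with b, e, K, C ∈ ℕ and b, e > 0.
--     Since E is a homomorphism (F,+) → (F,·), E(xt)^b = E(±K t) = 2^{±K};
--     multiplying by e^b and comparing natural numbers (characteristic 0) gives
--     C^b = p^K e^b or e^b = p^K C^b.  An equation c^n = p^k d^n with p prime and
--     d ≠ 0 forces n ∣ k (by reduction to k < n and infinite descent), so b ∣ K and
--     x = ±K/b is an integer.

open import Defs
open import Level using (Level)
open import Data.Nat as ℕ using (ℕ; zero; suc; NonZero)
import Data.Nat.Properties as ℕ
open import Data.Integer using (ℤ; +_; -[1+_]; ∣_∣)
open import Data.Integer.Properties using (+-injective)
open import Data.Product using (∃; ∃₂; _×_; _,_; proj₂)
open import Data.Sum using (_⊎_; inj₁; inj₂; [_,_]′)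
open import Data.Nat.Divisibility using (_∣_; divides)
open import Data.Nat.Primality using (Prime; prime[2])
open import Data.Empty using (⊥-elim)
open import Relation.Nullary using (¬_)
import Relation.Binary.PropositionalEquality as ≡

module NaturalPowers where

  open import Data.Nat using (ℕ; zero; suc; _+_; _*_; _^_; _<_; _%_; _/_; NonZero; ≢-nonZero; ≢-nonZero⁻¹; nonTrivial⇒n>1; nonTrivial⇒≢1)
  open import Data.Nat.Properties
  open import Data.Nat.Divisibility using (_∣_; divides; ∣1⇒≡1; m∣m*n; n∣m*n; ∣m⇒∣m*n; ∣-trans; m%n≡0⇒n∣m)
  open import Algebra.Properties.CommutativeSemigroup *-commutativeSemigroup using (x∙yz≈y∙xz)
  open import Data.Nat.DivMod using (m≡m%n+[m/n]*n; m%n<n)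
  open import Data.Nat.Induction using (<-wellFounded)
  open import Data.Nat.Primality using (Prime; euclidsLemma; prime⇒nonZero; prime⇒nonTrivial)
  open import Induction.WellFounded using (Acc; acc)
  open import Data.Empty using (⊥-elim)
  open import Data.Sum using ([_,_]′)
  open import Data.Product using (_,_)
  open import Function using (id)
  open import Relation.Binary.PropositionalEquality using (_≡_; _≢_; refl; sym; trans; cong; subst; module ≡-Reasoning)
  open ≡-Reasoning

  *-distrib-^ : ∀ a b n → (a * b) ^ n ≡ a ^ n * b ^ n
  *-distrib-^ a b zero    = refl
  *-distrib-^ a b (suc n) = begin
    a * b * (a * b) ^ n       ≡⟨ cong (a * b *_) (*-distrib-^ a b n) ⟩
    a * b * (a ^ n * b ^ n)   ≡⟨ [m*n]*[o*p]≡[m*o]*[n*p] a b (a ^ n) (b ^ n) ⟩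
    a * a ^ n * (b * b ^ n)   ∎

  module PrimePowerEquations {p : ℕ} (p-prime : Prime p) where

    private instance
      p≢0 : NonZero p
      p≢0 = prime⇒nonZero p-prime

    1<p : 1 < p
    1<p = nonTrivial⇒n>1 p {{prime⇒nonTrivial p-prime}}

    p∣c^n⇒p∣c : ∀ c n → p ∣ c ^ n → p ∣ c
    p∣c^n⇒p∣c c zero    p∣1 = ⊥-elim (nonTrivial⇒≢1 {{prime⇒nonTrivial p-prime}} (∣1⇒≡1 p∣1))
    p∣c^n⇒p∣c c (suc n) p∣c^1+n = [ id , p∣c^n⇒p∣c c n ]′ (euclidsLemma c (c ^ n) p-prime p∣c^1+n)

    -- Infinite descent: c^n = p^(1+r) d^n with n = 2 + r + s has no solution with d ≠ 0.
    -- Both c and d turn out divisible by p, and dividing them by p gives a solution with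
    -- smaller d; p^n-split records n = (1 + r) + (1 + s), the shape both cancellations use.
    module Descent (r s : ℕ) where

      n : ℕ
      n = suc (suc r + s)

      p^n-split : p ^ n ≡ p ^ suc r * p ^ suc s
      p^n-split = trans (cong (p ^_) (sym (+-suc (suc r) s))) (^-distribˡ-+-* p (suc r) (suc s))

      p∣c : ∀ c d → c ^ n ≡ p ^ suc r * d ^ n → p ∣ c
      p∣c c d eq = p∣c^n⇒p∣c c n (subst (p ∣_) (sym eq) (∣m⇒∣m*n (d ^ n) (m∣m*n (p ^ r))))

      divide-c : ∀ c' d → (c' * p) ^ n ≡ p ^ suc r * d ^ n → c' ^ n * p ^ suc s ≡ d ^ n
      divide-c c' d eq = *-cancelˡ-≡ _ _ (p ^ suc r) {{m^n≢0 p (suc r)}} (begin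
        p ^ suc r * (c' ^ n * p ^ suc s)  ≡⟨ x∙yz≈y∙xz (p ^ suc r) (c' ^ n) (p ^ suc s) ⟩
        c' ^ n * (p ^ suc r * p ^ suc s)  ≡⟨ cong (c' ^ n *_) p^n-split ⟨
        c' ^ n * p ^ n                    ≡⟨ *-distrib-^ c' p n ⟨
        (c' * p) ^ n                      ≡⟨ eq ⟩
        p ^ suc r * d ^ n                 ∎)

      p∣d : ∀ c' d → c' ^ n * p ^ suc s ≡ d ^ n → p ∣ d
      p∣d c' d eq = p∣c^n⇒p∣c d n (subst (p ∣_) eq (∣-trans (m∣m*n (p ^ s)) (n∣m*n (c' ^ n))))

      divide-d : ∀ c' d' → c' ^ n * p ^ suc s ≡ (d' * p) ^ n → c' ^ n ≡ p ^ suc r * d' ^ n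
      divide-d c' d' eq = *-cancelʳ-≡ _ _ (p ^ suc s) {{m^n≢0 p (suc s)}} (begin
        c' ^ n * p ^ suc s                ≡⟨ eq ⟩
        (d' * p) ^ n                      ≡⟨ *-distrib-^ d' p n ⟩
        d' ^ n * p ^ n                    ≡⟨ cong (d' ^ n *_) p^n-split ⟩
        d' ^ n * (p ^ suc r * p ^ suc s)  ≡⟨ *-assoc (d' ^ n) _ _ ⟨
        d' ^ n * p ^ suc r * p ^ suc s    ≡⟨ cong (_* p ^ suc s) (*-comm (d' ^ n) _) ⟩
        p ^ suc r * d' ^ n * p ^ suc s    ∎)

      no-solution : ∀ {d} → Acc _<_ d → ∀ c → d ≢ 0 → c ^ n ≢ p ^ suc r * d ^ n
      no-solution {d} (acc smaller) c d≢0 eq with p∣c c d eq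
      ... | divides c' refl with p∣d c' d (divide-c c' d eq)
      ... | divides d' refl =
        no-solution (smaller d'<d) c' d'≢0 (divide-d c' d' (divide-c c' (d' * p) eq))
        where
        d'≢0 : d' ≢ 0
        d'≢0 refl = d≢0 refl
        d'<d : d' < d' * p
        d'<d = m<m*n d' p {{≢-nonZero d'≢0}} 1<p

    exponent-below-n : ∀ n r c d → r < n → d ≢ 0 → c ^ n ≡ p ^ r * d ^ n → r ≡ 0
    exponent-below-n n zero    c d r<n d≢0 eq = refl
    exponent-below-n n (suc r) c d r<n d≢0 eq with m≤n⇒∃[o]m+o≡n r<n
    ... | s , refl = ⊥-elim (Descent.no-solution r s (<-wellFounded d) c d≢0 eq)

    -- If p^k d^n is an n-th power with d ≠ 0, then n ∣ k: write k = r + q n with r < n,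
    -- so that c^n = p^r (p^q d)^n, and apply the previous lemma.
    n∣k : ∀ n .{{_ : NonZero n}} k c d → d ≢ 0 → c ^ n ≡ p ^ k * d ^ n → n ∣ k
    n∣k n k c d d≢0 eq =
      m%n≡0⇒n∣m k n (exponent-below-n n r c (p ^ q * d) (m%n<n k n) p^qd≢0 eq′)
      where
      r q : ℕ
      r = k % n
      q = k / n
      p^qd≢0 : p ^ q * d ≢ 0
      p^qd≢0 = ≢-nonZero⁻¹ (p ^ q * d) {{m*n≢0 (p ^ q) d {{m^n≢0 p q}} {{≢-nonZero d≢0}}}}
      eq′ : c ^ n ≡ p ^ r * (p ^ q * d) ^ n
      eq′ = begin
        c ^ n                        ≡⟨ eq ⟩
        p ^ k * d ^ n                ≡⟨ cong (λ e → p ^ e * d ^ n) (m≡m%n+[m/n]*n k n) ⟩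
        p ^ (r + q * n) * d ^ n      ≡⟨ cong (_* d ^ n) (^-distribˡ-+-* p r (q * n)) ⟩
        p ^ r * p ^ (q * n) * d ^ n  ≡⟨ *-assoc (p ^ r) _ _ ⟩
        p ^ r * (p ^ (q * n) * d ^ n) ≡⟨ cong (λ e → p ^ r * (e * d ^ n)) (^-*-assoc p q n) ⟨
        p ^ r * ((p ^ q) ^ n * d ^ n) ≡⟨ cong (p ^ r *_) (*-distrib-^ (p ^ q) d n) ⟨
        p ^ r * (p ^ q * d) ^ n      ∎

module ExpFieldArithmetic {c ℓ : Level} (F : ExpField c ℓ) where

  open ExpField F
  open import Algebra.Properties.Ring ring using (-‿distribˡ-*; -‿distribʳ-*; -‿involutive; -0#≈0#; +-cancelˡ)
  open import Algebra.Properties.Semiring.Mult semiring using (×-homo-+; ×1-homo-*) renaming (_×_ to _×ₙ_)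
  open import Algebra.Properties.CommutativeSemiring.Exp commutativeSemiring using (_^_; ^-congˡ; ^-distrib-*)
  open import Algebra.Properties.CommutativeSemigroup *-commutativeSemigroup using (xy∙z≈y∙xz)
  open import Relation.Binary.Reasoning.Setoid setoid

  ι : ℕ → Carrier
  ι = natCast commRing

  ιℤ : ℤ → Carrier
  ιℤ = intCast commRing

  -- ι n is the library's n-fold sum n ×ₙ 1#, so ι is a semiring homomorphism ℕ → F
  ι≡×1 : ∀ n → ι n ≡.≡ n ×ₙ 1#
  ι≡×1 zero    = ≡.refl
  ι≡×1 (suc n) = ≡.cong (_+_ 1#) (ι≡×1 n)

  ι-+ : ∀ m n → ι (m ℕ.+ n) ≈ ι m + ι n
  ι-+ m n rewrite ι≡×1 m | ι≡×1 n | ι≡×1 (m ℕ.+ n) = ×-homo-+ 1# m n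

  ι-* : ∀ m n → ι (m ℕ.* n) ≈ ι m * ι n
  ι-* m n rewrite ι≡×1 m | ι≡×1 n | ι≡×1 (m ℕ.* n) = ×1-homo-* m n

  ι-^ : ∀ m n → ι (m ℕ.^ n) ≈ ι m ^ n
  ι-^ m zero    = +-identityʳ 1#
  ι-^ m (suc n) = trans (ι-* m (m ℕ.^ n)) (*-congˡ (ι-^ m n))

  ι-injective : ∀ {m n} → ι m ≈ ι n → m ≡.≡ n
  ι-injective {zero}  {zero}  _ = ≡.refl
  ι-injective {zero}  {suc n} e = ⊥-elim (char0 n (sym e))
  ι-injective {suc m} {zero}  e = ⊥-elim (char0 m e)
  ι-injective {suc m} {suc n} e = ≡.cong suc (ι-injective (+-cancelˡ 1# _ _ e))

  *-cancelʳ : ∀ {x y z} → ¬ (y ≈ 0#) → x * y ≈ z * y → x ≈ z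
  *-cancelʳ {x} {y} {z} y≉0 xy≈zy with proj₂ isField y y≉0
  ... | y⁻¹ , yy⁻¹≈1 = begin
    x              ≈⟨ *-identityʳ x ⟨
    x * 1#         ≈⟨ *-congˡ yy⁻¹≈1 ⟨
    x * (y * y⁻¹)  ≈⟨ *-assoc x y y⁻¹ ⟨
    x * y * y⁻¹    ≈⟨ *-congʳ xy≈zy ⟩
    z * y * y⁻¹    ≈⟨ *-assoc z y y⁻¹ ⟩
    z * (y * y⁻¹)  ≈⟨ *-congˡ yy⁻¹≈1 ⟩
    z * 1#         ≈⟨ *-identityʳ z ⟩
    z              ∎

  -- Equality up to sign: an equivalence compatible with products and powers, so the
  -- signs of the fractions representing rational numbers can be carried along uniformly.
  infix 4 _≈±_
  _≈±_ : Carrier → Carrier → Set ℓ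
  x ≈± y = x ≈ y ⊎ x ≈ - y

  ≈⇒≈± : ∀ {x y} → x ≈ y → x ≈± y
  ≈⇒≈± = inj₁

  ≈±-sym : ∀ {x y} → x ≈± y → y ≈± x
  ≈±-sym (inj₁ x≈y)  = inj₁ (sym x≈y)
  ≈±-sym (inj₂ x≈-y) = inj₂ (trans (sym (-‿involutive _)) (-‿cong (sym x≈-y)))

  ≈±-trans : ∀ {x y z} → x ≈± y → y ≈± z → x ≈± z
  ≈±-trans (inj₁ x≈y)  (inj₁ y≈z)  = inj₁ (trans x≈y y≈z)
  ≈±-trans (inj₁ x≈y)  (inj₂ y≈-z) = inj₂ (trans x≈y y≈-z)
  ≈±-trans (inj₂ x≈-y) (inj₁ y≈z)  = inj₂ (trans x≈-y (-‿cong y≈z))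
  ≈±-trans (inj₂ x≈-y) (inj₂ y≈-z) = inj₁ (trans x≈-y (trans (-‿cong y≈-z) (-‿involutive _)))

  ≈±-* : ∀ {x y u v} → x ≈± y → u ≈± v → x * u ≈± y * v
  ≈±-* (inj₁ x≈y)  (inj₁ u≈v)  = inj₁ (*-cong x≈y u≈v)
  ≈±-* (inj₁ x≈y)  (inj₂ u≈-v) = inj₂ (trans (*-cong x≈y u≈-v) (sym (-‿distribʳ-* _ _)))
  ≈±-* (inj₂ x≈-y) (inj₁ u≈v)  = inj₂ (trans (*-cong x≈-y u≈v) (sym (-‿distribˡ-* _ _)))
  ≈±-* {y = y} {v = v} (inj₂ x≈-y) (inj₂ u≈-v) = inj₁ (begin
    _ * _          ≈⟨ *-cong x≈-y u≈-v ⟩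
    - y * - v      ≈⟨ -‿distribˡ-* y (- v) ⟨
    - (y * - v)    ≈⟨ -‿cong (-‿distribʳ-* y v) ⟨
    - - (y * v)    ≈⟨ -‿involutive (y * v) ⟩
    y * v          ∎)

  ≈±-^ : ∀ {x y} n → x ≈± y → x ^ n ≈± y ^ n
  ≈±-^ zero    _    = inj₁ refl
  ≈±-^ (suc n) x≈±y = ≈±-* x≈±y (≈±-^ n x≈±y)

  ≈±-cancelʳ : ∀ {x y z} → ¬ (y ≈ 0#) → x * y ≈± z * y → x ≈± z
  ≈±-cancelʳ y≉0 (inj₁ xy≈zy)  = inj₁ (*-cancelʳ y≉0 xy≈zy)
  ≈±-cancelʳ y≉0 (inj₂ xy≈-zy) = inj₂ (*-cancelʳ y≉0 (trans xy≈-zy (-‿distribˡ-* _ _)))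

  -- up to sign, ι is still injective: ι m = - ι n forces ι (m + n) = 0, so m = n = 0
  ι-≈±-injective : ∀ {m n} → ι m ≈± ι n → m ≡.≡ n
  ι-≈±-injective         (inj₁ ιm≈ιn)  = ι-injective ιm≈ιn
  ι-≈±-injective {m} {n} (inj₂ ιm≈-ιn) =
    ≡.trans (ℕ.m+n≡0⇒m≡0 m m+n≡0) (≡.sym (ℕ.m+n≡0⇒n≡0 m m+n≡0))
    where
    m+n≡0 : m ℕ.+ n ≡.≡ 0
    m+n≡0 = ι-injective (trans (ι-+ m n) (trans (+-congʳ ιm≈-ιn) (-‿inverseˡ (ι n))))

  ιℤ≈±ι∣∣ : ∀ z → ιℤ z ≈± ι ∣ z ∣
  ιℤ≈±ι∣∣ (+ n)    = inj₁ refl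
  ιℤ≈±ι∣∣ -[1+ n ] = inj₂ refl

  ≈±ι⇒integer : ∀ {x} m → x ≈± ι m → InIntegers commRing x
  ≈±ι⇒integer m       (inj₁ x≈m)  = + m , x≈m
  ≈±ι⇒integer zero    (inj₂ x≈-0) = + 0 , trans x≈-0 -0#≈0#
  ≈±ι⇒integer (suc m) (inj₂ x≈-m) = -[1+ m ] , x≈-m

  -- a rational y satisfies y · (1 + B) = ± K for some natural numbers B, K
  -- (the sign of the denominator is moved to the numerator)
  rational⇒±fraction : ∀ {y} → InPrimeSubfield commRing y → ∃₂ λ B K → y * ι (suc B) ≈± ι K
  rational⇒±fraction (a , + zero   , b≢0 , _)     = ⊥-elim (b≢0 ≡.refl)
  rational⇒±fraction (a , + suc B  , _   , yb≈a)  =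
    B , ∣ a ∣ , ≈±-trans (≈⇒≈± yb≈a) (ιℤ≈±ι∣∣ a)
  rational⇒±fraction (a , -[1+ B ] , _   , yb≈a)  =
    B , ∣ a ∣ , ≈±-trans (≈±-* (≈⇒≈± refl) (≈±-sym (ιℤ≈±ι∣∣ -[1+ B ])))
                         (≈±-trans (≈⇒≈± yb≈a) (ιℤ≈±ι∣∣ a))

  E-ι* : ∀ n y → E (ι n * y) ≈ E y ^ n
  E-ι* zero    y = trans (E-cong (zeroˡ y)) E-0
  E-ι* (suc n) y = begin
    E ((1# + ι n) * y)         ≈⟨ E-cong (distribʳ y 1# (ι n)) ⟩
    E (1# * y + ι n * y)       ≈⟨ E-+ (1# * y) (ι n * y) ⟩
    E (1# * y) * E (ι n * y)   ≈⟨ *-cong (E-cong (*-identityˡ y)) (E-ι* n y) ⟩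
    E y * E y ^ n              ∎

  E-neg* : ∀ a y → E (- a * y) * E (a * y) ≈ 1#
  E-neg* a y = begin
    E (- a * y) * E (a * y)    ≈⟨ *-congʳ (E-cong (-‿distribˡ-* a y)) ⟨
    E (- (a * y)) * E (a * y)  ≈⟨ E-+ (- (a * y)) (a * y) ⟨
    E (- (a * y) + a * y)      ≈⟨ E-cong (-‿inverseˡ (a * y)) ⟩
    E 0#                       ≈⟨ E-0 ⟩
    1#                         ∎

  E-ι*-ι : ∀ {t} m → E t ≈ ι m → ∀ n → E (ι n * t) ≈ ι (m ℕ.^ n)
  E-ι*-ι {t} m Et≈m n = begin
    E (ι n * t)   ≈⟨ E-ι* n t ⟩
    E t ^ n       ≈⟨ ^-congˡ n Et≈m ⟩
    ι m ^ n       ≈⟨ ι-^ m n ⟨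
    ι (m ℕ.^ n)   ∎

  -- Raising E(xt) to the b-th power gives E(±K t) = p^{±K}, so in ℕ
  -- either C^b = p^K e^b or e^b = p^K C^b.
  denominator∣numerator : ∀ {p t x} → Prime p → E t ≈ ι p → ∀ B K D C →
    x * ι (suc B) ≈± ι K → E (x * t) * ι (suc D) ≈± ι C → suc B ∣ K
  denominator∣numerator {p} {t} {x} p-prime Et≈p B K D C xb≈±K qe≈±C =
    [ positive , negative ]′ xb≈±K
    where
    open NaturalPowers.PrimePowerEquations p-prime using (n∣k)

    b e : ℕ
    b = suc B
    e = suc D

    q p^K : Carrier
    q = E (x * t)
    p^K = ι (p ℕ.^ K)

    q^b≈E[xbt] : q ^ b ≈ E (x * ι b * t)
    q^b≈E[xbt] = begin
      q ^ b               ≈⟨ E-ι* b (x * t) ⟨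
      E (ι b * (x * t))   ≈⟨ E-cong (trans (sym (*-assoc (ι b) x t)) (*-congʳ (*-comm (ι b) x))) ⟩
      E (x * ι b * t)     ∎

    q^b·e^b≈±C^b : q ^ b * ι (e ℕ.^ b) ≈± ι (C ℕ.^ b)
    q^b·e^b≈±C^b = ≈±-trans (≈⇒≈± (begin
        q ^ b * ι (e ℕ.^ b)  ≈⟨ *-congˡ (ι-^ e b) ⟩
        q ^ b * ι e ^ b      ≈⟨ ^-distrib-* q (ι e) b ⟨
        (q * ι e) ^ b        ∎))
      (≈±-trans (≈±-^ b qe≈±C) (≈⇒≈± (sym (ι-^ C b))))

    -- x b = K: then q^b = p^K, hence C^b = p^K e^b
    positive : x * ι b ≈ ι K → b ∣ K
    positive xb≈K = n∣k b K C e (λ ()) (ι-≈±-injective C^b≈±p^K·e^b)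
      where
      q^b≈p^K : q ^ b ≈ p^K
      q^b≈p^K = trans q^b≈E[xbt] (trans (E-cong (*-congʳ xb≈K)) (E-ι*-ι p Et≈p K))
      C^b≈±p^K·e^b : ι (C ℕ.^ b) ≈± ι (p ℕ.^ K ℕ.* e ℕ.^ b)
      C^b≈±p^K·e^b = ≈±-trans (≈±-sym q^b·e^b≈±C^b) (≈⇒≈± (begin
        q ^ b * ι (e ℕ.^ b)        ≈⟨ *-congʳ q^b≈p^K ⟩
        p^K * ι (e ℕ.^ b)          ≈⟨ ι-* (p ℕ.^ K) (e ℕ.^ b) ⟨
        ι (p ℕ.^ K ℕ.* e ℕ.^ b)    ∎))

    -- x b = -K: then q^b p^K = 1, hence e^b = p^K C^b, and C ≠ 0 because e ≠ 0
    negative : x * ι b ≈ - ι K → b ∣ K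
    negative xb≈-K = n∣k b K e C C≢0 e^b≡p^K·C^b
      where
      q^b·p^K≈1 : q ^ b * p^K ≈ 1#
      q^b·p^K≈1 = begin
        q ^ b * p^K                  ≈⟨ *-congʳ q^b≈E[xbt] ⟩
        E (x * ι b * t) * p^K        ≈⟨ *-cong (E-cong (*-congʳ xb≈-K)) (sym (E-ι*-ι p Et≈p K)) ⟩
        E (- ι K * t) * E (ι K * t)  ≈⟨ E-neg* (ι K) t ⟩
        1#                           ∎
      e^b≡p^K·C^b : e ℕ.^ b ≡.≡ p ℕ.^ K ℕ.* C ℕ.^ b
      e^b≡p^K·C^b = ι-≈±-injective (≈±-trans (≈⇒≈± (begin
          ι (e ℕ.^ b)                  ≈⟨ *-identityˡ _ ⟨
          1# * ι (e ℕ.^ b)             ≈⟨ *-congʳ q^b·p^K≈1 ⟨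
          q ^ b * p^K * ι (e ℕ.^ b)    ≈⟨ xy∙z≈y∙xz (q ^ b) p^K _ ⟩
          p^K * (q ^ b * ι (e ℕ.^ b))  ∎))
        (≈±-trans (≈±-* (≈⇒≈± refl) q^b·e^b≈±C^b) (≈⇒≈± (sym (ι-* (p ℕ.^ K) (C ℕ.^ b))))))
      C≢0 : ¬ (C ≡.≡ 0)
      C≢0 ≡.refl with ℕ.m^n≡0⇒m≡0 e b (≡.trans e^b≡p^K·C^b (ℕ.*-zeroʳ (p ℕ.^ K)))
      ... | ()

  -- (⇒): x b = ±K with b ∣ K, so cancelling b ≠ 0 leaves x = ±(K / b) ∈ ℤ
  Θ⇒integer : ∀ x → Θ F x → InIntegers commRing x
  Θ⇒integer x (t , Et≈2 , q∈ℚ , x∈ℚ) with rational⇒±fraction x∈ℚ | rational⇒±fraction q∈ℚ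
  ... | B , K , xb≈±K | D , C , qe≈±C with denominator∣numerator prime[2] Et≈2 B K D C xb≈±K qe≈±C
  ... | divides m ≡.refl =
    ≈±ι⇒integer m (≈±-cancelʳ (char0 B) (≈±-trans xb≈±K (≈⇒≈± (ι-* m (suc B)))))

  ∈ℚ-resp-≈ : ∀ {x y} → x ≈ y → InPrimeSubfield commRing y → InPrimeSubfield commRing x
  ∈ℚ-resp-≈ x≈y (a , b , b≢0 , yb≈a) = a , b , b≢0 , trans (*-congʳ x≈y) yb≈a

  integer⇒rational : ∀ {x} z → x ≈ ιℤ z → InPrimeSubfield commRing x
  integer⇒rational {x} z x≈z =
    z , + 1 , (λ ()) , trans (*-congˡ (+-identityʳ 1#)) (trans (*-identityʳ x) x≈z)

  E[zt]∈ℚ : ∀ {t} m .{{_ : NonZero m}} → E t ≈ ι m → ∀ z → InPrimeSubfield commRing (E (ιℤ z * t))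
  E[zt]∈ℚ     m Et≈m (+ k)    = integer⇒rational (+ (m ℕ.^ k)) (E-ι*-ι m Et≈m k)
  E[zt]∈ℚ {t} m Et≈m -[1+ k ] = + 1 , + (m ℕ.^ suc k) , m^k≢0 , (begin
      E (- ι (suc k) * t) * ι (m ℕ.^ suc k)     ≈⟨ *-congˡ (E-ι*-ι m Et≈m (suc k)) ⟨
      E (- ι (suc k) * t) * E (ι (suc k) * t)   ≈⟨ E-neg* (ι (suc k)) t ⟩
      1#                                        ≈⟨ +-identityʳ 1# ⟨
      ι 1                                       ∎)
    where
    m^k≢0 : ¬ (+ (m ℕ.^ suc k) ≡.≡ + 0)
    m^k≢0 eq = ℕ.≢-nonZero⁻¹ (m ℕ.^ suc k) {{ℕ.m^n≢0 m (suc k)}} (+-injective eq)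

  -- (⇐): for x = z ∈ ℤ the same t witnesses Θ, since E(z t) = 2^z ∈ ℚ
  integer⇒Θ : ∀ {t} → E t ≈ ι 2 → ∀ x → InIntegers commRing x → Θ F x
  integer⇒Θ {t} Et≈2 x (z , x≈z) =
    t , Et≈2 , ∈ℚ-resp-≈ (E-cong (*-congʳ x≈z)) (E[zt]∈ℚ 2 Et≈2 z) , integer⇒rational z x≈z

mainTheorem3 : ∀ {c ℓ : Level} (F : ExpField c ℓ)
    → (∃ λ t → ExpField._≈_ F (ExpField.E F t) (natCast (ExpField.commRing F) 2))
    → ∀ x → (Θ F x → InIntegers (ExpField.commRing F) x)
           × (InIntegers (ExpField.commRing F) x → Θ F x)
mainTheorem3 F (t , Et≈2) x = Θ⇒integer x , integer⇒Θ Et≈2 x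
  where open ExpFieldArithmetic F
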